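{- Let $G$ be a subgroup of $S_n$ and let $Z_G=\frac{1}{|G|}\sum_{g\in G}p_{\lambda(g)}\in\mathsf{Sym}$ be its cycle index polynomial. Then $Z_G$ has saturated Newton polytope.
   Context: $\lambda(g)$ is the cycle type of $g$, $p_k=\sum_i x_i^k$ and $p_\lambda=p_{\lambda_1}p_{\lambda_2}\cdots$, in the ring $\mathsf{Sym}$ of symmetric functions in $x_1,x_2,\ldots$. A polynomial $h=\sum c_\alpha x^\alpha$ has saturated Newton polytope (SNP) if every lattice point of $\mathrm{conv}\{\alpha:c_\alpha\neq0\}$ is an exponent vector with nonzero coefficient; $f\in\mathsf{Sym}$ is SNP if $f(x_1,\ldots,x_m)$ (setting $x_i=0$ for $i>m$) is SNP for every $m\geq1$. -}

module Defs where

open import Data.Nat as ℕ using (ℕ; zero; suc)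
open import Data.Fin using (Fin)
open import Data.Fin.Properties using () renaming (_≟_ to _≟ᶠ_)
open import Data.Fin.Permutation using (Permutation′; _⟨$⟩ʳ_; _⟨$⟩ˡ_; _≈_)
open import Data.List as List using (List; []; _∷_; _++_; map; concatMap; replicate; length; filter; allFin; upTo; foldr)
open import Data.List.Relation.Unary.All using (All)
open import Data.List.Relation.Unary.Any using (Any)
open import Data.List.Relation.Unary.AllPairs using (AllPairs)
open import Data.Vec as Vec using (Vec; zipWith; tabulate)
import Data.Vec.Properties as VecP
open import Data.Product using (_×_; _,_; Σ; proj₁; proj₂)
open import Data.Integer using (+_)
open import Data.Rational as ℚ using (ℚ; 0ℚ; 1ℚ; _≤_)
open import Relation.Binary.PropositionalEquality using (_≡_)
open import Relation.Nullary using (¬_; yes; no)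

record Subgroup (n : ℕ) : Set where
  field
    elems    : List (Permutation′ n)
    distinct : AllPairs (λ g h → ¬ (g ≈ h)) elems
    hasId    : Any (λ e → ∀ i → e ⟨$⟩ʳ i ≡ i) elems
    closed∘  : All (λ g → All (λ h →
                 Any (λ k → ∀ i → k ⟨$⟩ʳ i ≡ g ⟨$⟩ʳ (h ⟨$⟩ʳ i)) elems) elems) elems
    closed⁻¹ : All (λ g → Any (λ k → ∀ i → k ⟨$⟩ʳ i ≡ g ⟨$⟩ˡ i) elems) elems

iter : ∀ {n} → Permutation′ n → ℕ → Fin n → Fin n
iter g zero    i = i
iter g (suc k) i = g ⟨$⟩ʳ (iter g k i)

-- least k in [s, s+fuel) with g^k i = i (default: s+fuel)
search : ∀ {n} → Permutation′ n → Fin n → ℕ → ℕ → ℕ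
search g i s zero = s
search g i s (suc fuel) with iter g s i ≟ᶠ i
... | yes _ = s
... | no  _ = search g i (suc s) fuel

-- length of the cycle of g containing i: least k ≥ 1 with g^k i = i
-- (such a k ≤ n always exists)
cycleLen : ∀ {n} → Permutation′ n → Fin n → ℕ
cycleLen {n} g i = search g i 1 n

numCycles : ∀ {n} → Permutation′ n → ℕ → ℕ
numCycles g zero    = 0
numCycles {n} g (suc j) =
  length (filter (λ i → cycleLen g i ℕ.≟ suc j) (allFin n)) ℕ./ suc j

cycleType : ∀ {n} → Permutation′ n → List ℕ
cycleType {n} g = concatMap (λ j → replicate (numCycles g (suc j)) (suc j)) (upTo n)

-- Polynomials in m variables x_1..x_m with rational coefficients,
-- as finite lists of terms (exponent vector, coefficient).
-- The coefficient of a monomial is the sum over matching terms.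

Mon : ℕ → Set
Mon m = Vec ℕ m

Poly : ℕ → Set
Poly m = List (Mon m × ℚ)

coeff : ∀ {m} → Mon m → Poly m → ℚ
coeff α [] = 0ℚ
coeff α ((β , c) ∷ P) with VecP.≡-dec ℕ._≟_ β α
... | yes _ = c ℚ.+ coeff α P
... | no  _ = coeff α P

_+P_ : ∀ {m} → Poly m → Poly m → Poly m
_+P_ = _++_

_*P_ : ∀ {m} → Poly m → Poly m → Poly m
P *P Q = concatMap (λ { (a , c) → map (λ { (b , d) → (zipWith ℕ._+_ a b , c ℚ.* d) }) Q }) P

scaleP : ∀ {m} → ℚ → Poly m → Poly m
scaleP t = map (λ { (a , c) → (a , t ℚ.* c) })

oneP : ∀ {m} → Poly m
oneP = (Vec.replicate _ 0 , 1ℚ) ∷ []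

powerSum : (m k : ℕ) → Poly m
powerSum m k = map (λ i → (tabulate (λ j → unit i j) , 1ℚ)) (allFin m)
  where
  unit : Fin m → Fin m → ℕ
  unit i j with i ≟ᶠ j
  ... | yes _ = k
  ... | no  _ = 0

pλ : (m : ℕ) → List ℕ → Poly m
pλ m λs = foldr (λ k P → powerSum m k *P P) oneP λs

-- 1/k as a rational (k ≥ 1 in all uses)
inv : ℕ → ℚ
inv zero    = 0ℚ
inv (suc k) = + 1 ℚ./ suc k

cycleIndex : ∀ {n} → Subgroup n → (m : ℕ) → Poly m
cycleIndex G m =
  scaleP (inv (length (Subgroup.elems G)))
         (foldr (λ g P → pλ m (cycleType g) +P P) [] (Subgroup.elems G))

toℚ : ℕ → ℚ
toℚ k = + k ℚ./ 1

-- α lies in the convex hull of the support of h: α is a convex combination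
-- (rational weights) of finitely many exponent vectors β with coeff β h ≠ 0.
InNewtonPolytope : ∀ {m} → Poly m → Mon m → Set
InNewtonPolytope {m} h α =
  Σ (List (Mon m × ℚ)) λ L →
      All (λ { (β , t) → ¬ (coeff β h ≡ 0ℚ) × 0ℚ ≤ t }) L
    × foldr (λ { (β , t) s → t ℚ.+ s }) 0ℚ L ≡ 1ℚ
    × (∀ (j : Fin m) →
         foldr (λ { (β , t) s → t ℚ.* toℚ (Vec.lookup β j) ℚ.+ s }) 0ℚ L
           ≡ toℚ (Vec.lookup α j))

HasSNP : ∀ {m} → Poly m → Set
HasSNP {m} h = ∀ (α : Mon m) → InNewtonPolytope h α → ¬ (coeff α h ≡ 0ℚ)

-- A family in Sym given by its specialisations to m variables is SNP
-- if each specialisation is.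
SymSNP : ((m : ℕ) → Poly m) → Set
SymSNP f = ∀ m → HasSNP (f m)

module Submission where

-- Proof.  (1) Each cycle type λ(g) is a partition of n.  Hence every term of
-- every p_{λ(g)} has degree n, and so does every lattice point α of the
-- Newton polytope of Z_G, being a convex combination of such exponents.
-- (2) Every term of Z_G has the positive coefficient 1/|G|, so a monomial
-- that occurs in the term list has nonzero coefficient.  The identity lies in
-- G and has cycle type (1ⁿ); p_1ⁿ contains every monomial of degree n, in
-- particular α.

open import Defs
open import Data.Nat as ℕ using (ℕ; zero; suc; _+_; _*_; _∸_; _≤_; _<_; z≤n; s≤s; s≤s⁻¹; NonZero; _≤?_)
import Data.Nat.Properties as ℕP
open import Data.Nat.DivMod using (_%_; _/_; m≡m%n+[m/n]*n; m%n<n; m/n*n≡m; n/1≡n)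
open import Data.Nat.Divisibility using (_∣_; divides)
open import Data.Nat.Coprimality as Coprime using ()
open import Data.Nat.ListAction using () renaming (sum to sumL)
open import Data.Nat.ListAction.Properties using (sum-++)
open import Data.Fin as F using (Fin; toℕ; fromℕ<)
open import Data.Fin.Properties using (pigeonhole; toℕ-injective; toℕ<n; toℕ-fromℕ<; all?; suc-injective) renaming (_≟_ to _≟ᶠ_)
open import Data.Fin.Permutation using (Permutation′; _⟨$⟩ʳ_; _⟨$⟩ˡ_; inverseˡ)
open import Data.Vec as Vec using (Vec; zipWith; tabulate; lookup)
import Data.Vec.Properties as VecP
open import Data.Vec.Relation.Binary.Pointwise.Extensional using (ext; Pointwise-≡⇒≡)
open import Data.List as List using (List; []; _∷_; _++_; map; concatMap; replicate; length; filter; allFin; upTo; applyUpTo; foldr)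
open import Data.List.Properties using (++-identityʳ)
open import Data.List.Relation.Unary.All as All using (All; []; _∷_)
open import Data.List.Relation.Unary.Any as Any using (Any; here; there)
import Data.List.Relation.Unary.All.Properties as AllP
import Data.List.Relation.Unary.Any.Properties as AnyP
open import Data.List.Membership.Propositional using (_∈_)
open import Data.List.Membership.Propositional.Properties using (∈-allFin)
open import Data.Product using (Σ; _×_; _,_; proj₁; proj₂)
open import Data.Sum using (_⊎_; inj₁; inj₂)
open import Data.Empty using (⊥-elim)
import Data.Integer as ℤ
import Data.Integer.Properties as ℤP
open import Data.Rational as ℚ using (ℚ; 0ℚ; 1ℚ; mkℚ)
import Data.Rational.Properties as ℚP
open import Relation.Nullary using (Dec; yes; no; ¬_)
open import Relation.Binary.PropositionalEquality
open import Relation.Binary.Definitions using (tri<; tri≈; tri>)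
open import Function using (_∘_; id)
import Algebra.Properties.CommutativeMonoid.Sum as CommutativeMonoidSum
import Algebra.Properties.Semiring.Sum as SemiringSum
open import Algebra.Bundles using (CommutativeRing)

module ΣN = CommutativeMonoidSum ℕP.+-0-commutativeMonoid
module ΣQ = CommutativeMonoidSum ℚP.+-0-commutativeMonoid
module SN = SemiringSum ℕP.+-*-semiring
module SQ = SemiringSum (CommutativeRing.semiring ℚP.+-*-commutativeRing)

ind : ∀ {P : Set} → Dec P → ℕ
ind (yes _) = 1
ind (no _)  = 0

ind-yes : ∀ {P : Set} (d : Dec P) → P → ind d ≡ 1
ind-yes (yes _) _ = refl
ind-yes (no ¬p) p = ⊥-elim (¬p p)

ind-no : ∀ {P : Set} (d : Dec P) → ¬ P → ind d ≡ 0
ind-no (yes p) ¬p = ⊥-elim (¬p p)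
ind-no (no _)  _  = refl

sum-zero : ∀ {k} (h : Fin k → ℕ) → (∀ j → h j ≡ 0) → ΣN.sum h ≡ 0
sum-zero {k} h h≡0 = trans (ΣN.sum-cong-≗ h≡0) (ΣN.sum-replicate-zero k)

sum-zero⁻¹ : ∀ {k} (h : Fin k → ℕ) → ΣN.sum h ≡ 0 → ∀ j → h j ≡ 0
sum-zero⁻¹ h e F.zero    = ℕP.m+n≡0⇒m≡0 (h F.zero) e
sum-zero⁻¹ h e (F.suc j) = sum-zero⁻¹ (h ∘ F.suc) (ℕP.m+n≡0⇒n≡0 (h F.zero) e) j

sum-positive : ∀ {k} (h : Fin k → ℕ) {r} → ΣN.sum h ≡ suc r → Σ (Fin k) λ j → 1 ≤ h j
sum-positive {zero} h ()
sum-positive {suc k} h e with h F.zero in eq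
... | suc _ = F.zero , subst (1 ≤_) (sym eq) (s≤s z≤n)
... | zero with sum-positive (h ∘ F.suc) e
...   | j , p = F.suc j , p

sum-const : ∀ k c → ΣN.sum {k} (λ _ → c) ≡ k * c
sum-const zero    c = refl
sum-const (suc k) c = cong (c +_) (sum-const k c)

sum-single : ∀ {k} (h : Fin k → ℕ) (j₀ : Fin k) {v} → h j₀ ≡ v → (∀ j → j ≢ j₀ → h j ≡ 0) → ΣN.sum h ≡ v
sum-single h F.zero {v} hv h0 =
  trans (cong₂ _+_ hv (sum-zero (h ∘ F.suc) (λ j → h0 (F.suc j) (λ ())))) (ℕP.+-identityʳ v)
sum-single h (F.suc j₀) hv h0 =
  cong₂ _+_ (h0 F.zero (λ ())) (sum-single (h ∘ F.suc) j₀ hv (λ j j≢ → h0 (F.suc j) (j≢ ∘ suc-injective)))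

length-filter : ∀ {A : Set} {k} {P : A → Set} (P? : ∀ x → Dec (P x)) (f : Fin k → A) →
                length (filter P? (List.tabulate f)) ≡ ΣN.sum (λ i → ind (P? (f i)))
length-filter {k = zero}  P? f = refl
length-filter {k = suc k} P? f with P? (f F.zero)
... | yes _ = cong suc (length-filter P? (f ∘ F.suc))
... | no _  = length-filter P? (f ∘ F.suc)

argmin : ∀ k → 0 < k → (h : ℕ → ℕ) → Σ ℕ λ j₀ → j₀ < k × (∀ j → j < k → h j₀ ≤ h j)
argmin (suc zero) _ h = 0 , s≤s z≤n , λ { zero _ → ℕP.≤-refl ; (suc j) (s≤s ()) }
argmin (suc (suc k)) _ h with argmin (suc k) (s≤s z≤n) h
... | j₁ , j₁<k , min₁ with h j₁ ≤? h (suc k)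
...   | yes le = j₁ , ℕP.m<n⇒m<1+n j₁<k , λ j j< → extend j (ℕP.m<1+n⇒m<n∨m≡n j<)
  where
  extend : ∀ j → j < suc k ⊎ j ≡ suc k → h j₁ ≤ h j
  extend j (inj₁ l)    = min₁ j l
  extend j (inj₂ refl) = le
...   | no nle = suc k , ℕP.n<1+n (suc k) , λ j j< → extend j (ℕP.m<1+n⇒m<n∨m≡n j<)
  where
  extend : ∀ j → j < suc k ⊎ j ≡ suc k → h (suc k) ≤ h j
  extend j (inj₁ l)    = ℕP.≤-trans (ℕP.≰⇒≥ nle) (min₁ j l)
  extend j (inj₂ refl) = ℕP.≤-refl

sumL-replicate : ∀ a b → sumL (replicate a b) ≡ a * b
sumL-replicate zero    b = refl
sumL-replicate (suc a) b = cong (b +_) (sumL-replicate a b)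

sumL-concatMap : ∀ {A : Set} (G : A → List ℕ) xs → sumL (concatMap G xs) ≡ sumL (map (sumL ∘ G) xs)
sumL-concatMap G []       = refl
sumL-concatMap G (x ∷ xs) = trans (sum-++ (G x) (concatMap G xs)) (cong (sumL (G x) +_) (sumL-concatMap G xs))

sumL-applyUpTo : ∀ k (h f : ℕ → ℕ) → sumL (map h (applyUpTo f k)) ≡ ΣN.sum {k} (λ j → h (f (toℕ j)))
sumL-applyUpTo zero    h f = refl
sumL-applyUpTo (suc k) h f = cong (h (f 0) +_) (sumL-applyUpTo k h (f ∘ suc))

concatMap-empty : ∀ (G : ℕ → List ℕ) k (f : ℕ → ℕ) → (∀ j → G (f j) ≡ []) → concatMap G (applyUpTo f k) ≡ []
concatMap-empty G zero    f h = refl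
concatMap-empty G (suc k) f h =
  trans (cong (_++ concatMap G (applyUpTo (f ∘ suc) k)) (h 0)) (concatMap-empty G k (f ∘ suc) (h ∘ suc))

module Orbit {n : ℕ} (g : Permutation′ n) where

  iter-comm : ∀ k i → iter g k (g ⟨$⟩ʳ i) ≡ g ⟨$⟩ʳ iter g k i
  iter-comm zero    i = refl
  iter-comm (suc k) i = cong (g ⟨$⟩ʳ_) (iter-comm k i)

  iter-+ : ∀ a b i → iter g (a + b) i ≡ iter g a (iter g b i)
  iter-+ zero    b i = refl
  iter-+ (suc a) b i = cong (g ⟨$⟩ʳ_) (iter-+ a b i)

  g-injective : ∀ {x y} → g ⟨$⟩ʳ x ≡ g ⟨$⟩ʳ y → x ≡ y
  g-injective e = trans (sym (inverseˡ g)) (trans (cong (g ⟨$⟩ˡ_) e) (inverseˡ g))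

  iter-injective : ∀ k {x y} → iter g k x ≡ iter g k y → x ≡ y
  iter-injective zero    e = e
  iter-injective (suc k) e = iter-injective k (g-injective e)

  iter-cancel : ∀ a d i → iter g (a + d) i ≡ iter g a i → iter g d i ≡ i
  iter-cancel a d i e = iter-injective a (trans (sym (iter-+ a d i)) e)

  iter-gap : ∀ {a b} i → a < b → iter g a i ≡ iter g b i → iter g (b ∸ a) i ≡ i
  iter-gap {a} {b} i a<b e =
    iter-cancel a (b ∸ a) i (trans (cong (λ z → iter g z i) (ℕP.m+[n∸m]≡n (ℕP.<⇒≤ a<b))) (sym e))

  -- Every point returns to itself after at most n steps (pigeonhole on g^0 i, …, g^n i).
  recurrence : ∀ i → Σ ℕ λ k → 1 ≤ k × k ≤ n × iter g k i ≡ i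
  recurrence i with pigeonhole (ℕP.n<1+n n) (λ (j : Fin (suc n)) → iter g (toℕ j) i)
  ... | a , b , a<b , e =
    toℕ b ∸ toℕ a , ℕP.m<n⇒0<n∸m a<b ,
    ℕP.≤-trans (ℕP.m∸n≤m (toℕ b) (toℕ a)) (s≤s⁻¹ (toℕ<n b)) , iter-gap i a<b e

  Period : Fin n → ℕ → Set
  Period i k = 1 ≤ k × iter g k i ≡ i × (∀ t → 1 ≤ t → t < k → iter g t i ≢ i)

  period-unique : ∀ {i k k'} → Period i k → Period i k' → k ≡ k'
  period-unique {k = k} {k'} (k≥1 , fix , min) (k'≥1 , fix' , min') with ℕP.<-cmp k k'
  ... | tri< lt _ _ = ⊥-elim (min' k k≥1 lt fix)
  ... | tri≈ _ e _  = e
  ... | tri> _ _ gt = ⊥-elim (min k' k'≥1 gt fix')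

  search-spec : ∀ i s fuel →
      s ≤ search g i s fuel × search g i s fuel ≤ s + fuel ×
      (∀ t → s ≤ t → t < search g i s fuel → iter g t i ≢ i) ×
      (search g i s fuel < s + fuel → iter g (search g i s fuel) i ≡ i)
  search-spec i s zero =
    ℕP.≤-refl , ℕP.≤-reflexive (sym (ℕP.+-identityʳ s)) ,
    (λ t s≤t t<s → ⊥-elim (ℕP.<⇒≱ t<s s≤t)) , (λ lt → ⊥-elim (ℕP.<⇒≢ lt (sym (ℕP.+-identityʳ s))))
  search-spec i s (suc fuel) with iter g s i ≟ᶠ i
  ... | yes p = ℕP.≤-refl , ℕP.m≤m+n s (suc fuel) , (λ t s≤t t<s → ⊥-elim (ℕP.<⇒≱ t<s s≤t)) , (λ _ → p)
  ... | no ¬p with search-spec i (suc s) fuel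
  ...   | lower , upper , before , found =
    ℕP.≤-trans (ℕP.n≤1+n s) lower , subst (r ≤_) (sym (ℕP.+-suc s fuel)) upper , before' ,
    (λ lt → found (subst (r <_) (ℕP.+-suc s fuel) lt))
    where
    r : ℕ
    r = search g i (suc s) fuel
    before' : ∀ t → s ≤ t → t < r → iter g t i ≢ i
    before' t s≤t lt with ℕP.m≤n⇒m<n∨m≡n s≤t
    ... | inj₁ s<t  = before t s<t lt
    ... | inj₂ refl = ¬p

  cycleLen-spec : ∀ i → Period i (cycleLen g i) × cycleLen g i ≤ n
  cycleLen-spec i with search-spec i 1 n
  ... | lower , upper , before , found with ℕP.m≤n⇒m<n∨m≡n upper
  ...   | inj₁ lt = (lower , found lt , before) , s≤s⁻¹ lt
  ...   | inj₂ eq with recurrence i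
  ...     | k , k≥1 , k≤n , fix = ⊥-elim (before k k≥1 (subst (k <_) (sym eq) (s≤s k≤n)) fix)

  cycleLen-unique : ∀ {i k} → Period i k → cycleLen g i ≡ k
  cycleLen-unique = period-unique (proj₁ (cycleLen-spec _))

  cycleLen-pos : ∀ i → 1 ≤ cycleLen g i
  cycleLen-pos i = proj₁ (proj₁ (cycleLen-spec i))

  cycleLen-fix : ∀ i → iter g (cycleLen g i) i ≡ i
  cycleLen-fix i = proj₁ (proj₂ (proj₁ (cycleLen-spec i)))

  cycleLen-min : ∀ i t → 1 ≤ t → t < cycleLen g i → iter g t i ≢ i
  cycleLen-min i = proj₂ (proj₂ (proj₁ (cycleLen-spec i)))

  cycleLen-≤ : ∀ i → cycleLen g i ≤ n
  cycleLen-≤ i = proj₂ (cycleLen-spec i)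

  cycleLen-g : ∀ i → cycleLen g (g ⟨$⟩ʳ i) ≡ cycleLen g i
  cycleLen-g i = cycleLen-unique
    ( cycleLen-pos i
    , trans (iter-comm (cycleLen g i) i) (cong (g ⟨$⟩ʳ_) (cycleLen-fix i))
    , λ t t≥1 t<k e → cycleLen-min i t t≥1 t<k (g-injective (trans (sym (iter-comm t i)) e)))

  cycleLen-iter : ∀ j i → cycleLen g (iter g j i) ≡ cycleLen g i
  cycleLen-iter zero    i = refl
  cycleLen-iter (suc j) i = trans (cycleLen-g (iter g j i)) (cycleLen-iter j i)

  iter-mult : ∀ i k → iter g k i ≡ i → ∀ q → iter g (q * k) i ≡ i
  iter-mult i k fix zero    = refl
  iter-mult i k fix (suc q) = trans (iter-+ k (q * k) i) (trans (cong (iter g k) (iter-mult i k fix q)) fix)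

  iter-mod : ∀ i k → iter g k i ≡ i → .{{_ : NonZero k}} → ∀ a → iter g a i ≡ iter g (a % k) i
  iter-mod i k fix a = begin
    iter g a i                                   ≡⟨ cong (λ z → iter g z i) (m≡m%n+[m/n]*n a k) ⟩
    iter g (a % k + (a / k) * k) i               ≡⟨ iter-+ (a % k) ((a / k) * k) i ⟩
    iter g (a % k) (iter g ((a / k) * k) i)      ≡⟨ cong (iter g (a % k)) (iter-mult i k fix (a / k)) ⟩
    iter g (a % k) i                             ∎
    where open ≡-Reasoning

  orbit-injective : ∀ i a b → a < cycleLen g i → b < cycleLen g i → iter g a i ≡ iter g b i → a ≡ b
  orbit-injective i a b a<k b<k e with ℕP.<-cmp a b
  ... | tri≈ _ a≡b _ = a≡b
  ... | tri< a<b _ _ = ⊥-elim (cycleLen-min i (b ∸ a) (ℕP.m<n⇒0<n∸m a<b)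
                         (ℕP.≤-<-trans (ℕP.m∸n≤m b a) b<k) (iter-gap i a<b e))
  ... | tri> _ _ b<a = ⊥-elim (cycleLen-min i (a ∸ b) (ℕP.m<n⇒0<n∸m b<a)
                         (ℕP.≤-<-trans (ℕP.m∸n≤m a b) a<k) (iter-gap i b<a (sym e)))

  reach : ∀ i a b → a < cycleLen g i → Σ (Fin n) λ d → iter g (toℕ d) (iter g a i) ≡ iter g b i
  reach i a b a<k = fromℕ< d<n , trans (cong (λ z → iter g z x) (toℕ-fromℕ< d<n)) (trans (sym (iter-mod x k fix-x d₀)) step)
    where
    k : ℕ
    k = cycleLen g i
    instance
      k≢0 : NonZero k
      k≢0 = ℕ.>-nonZero (cycleLen-pos i)
    x : Fin n
    x = iter g a i
    d₀ : ℕ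
    d₀ = (b + k) ∸ a
    d<n : d₀ % k < n
    d<n = ℕP.≤-trans (m%n<n d₀ k) (cycleLen-≤ i)
    fix-x : iter g k x ≡ x
    fix-x = subst (λ z → iter g z x ≡ x) (cycleLen-iter a i) (cycleLen-fix x)
    step : iter g d₀ x ≡ iter g b i
    step = begin
      iter g d₀ (iter g a i)    ≡⟨ sym (iter-+ d₀ a i) ⟩
      iter g (d₀ + a) i         ≡⟨ cong (λ z → iter g z i) (ℕP.m∸n+n≡m (ℕP.≤-trans (ℕP.<⇒≤ a<k) (ℕP.m≤n+m k b))) ⟩
      iter g (b + k) i          ≡⟨ iter-+ b k i ⟩
      iter g b (iter g k i)     ≡⟨ cong (iter g b) (cycleLen-fix i) ⟩
      iter g b i                ∎
      where open ≡-Reasoning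

  IsMin : Fin n → Set
  IsMin x = ∀ (j : Fin n) → toℕ x ≤ toℕ (iter g (toℕ j) x)

  isMin? : ∀ x → Dec (IsMin x)
  isMin? x = all? (λ j → toℕ x ≤? toℕ (iter g (toℕ j) x))

  -- The point g^j₀ i with smallest label among g^0 i, …, g^(k-1) i is the orbit minimum.
  orbit-min : ∀ i → Σ ℕ λ j₀ → j₀ < cycleLen g i × IsMin (iter g j₀ i)
  orbit-min i = j₀ , j₀<k , λ j →
    subst (λ z → toℕ (iter g j₀ i) ≤ toℕ z) (sym (shift j)) (least ((toℕ j + j₀) % k) (m%n<n (toℕ j + j₀) k))
    where
    k : ℕ
    k = cycleLen g i
    instance
      k≢0 : NonZero k
      k≢0 = ℕ.>-nonZero (cycleLen-pos i)
    smallest : Σ ℕ λ j₀ → j₀ < k × (∀ j → j < k → toℕ (iter g j₀ i) ≤ toℕ (iter g j i))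
    smallest = argmin k (cycleLen-pos i) (λ j → toℕ (iter g j i))
    j₀ : ℕ
    j₀ = proj₁ smallest
    j₀<k : j₀ < k
    j₀<k = proj₁ (proj₂ smallest)
    least : ∀ j → j < k → toℕ (iter g j₀ i) ≤ toℕ (iter g j i)
    least = proj₂ (proj₂ smallest)
    shift : ∀ (j : Fin n) → iter g (toℕ j) (iter g j₀ i) ≡ iter g ((toℕ j + j₀) % k) i
    shift j = trans (sym (iter-+ (toℕ j) j₀ i)) (iter-mod i k (cycleLen-fix i) (toℕ j + j₀))

  orbit-min-unique : ∀ i a b → a < cycleLen g i → b < cycleLen g i →
                     IsMin (iter g a i) → IsMin (iter g b i) → a ≡ b
  orbit-min-unique i a b a<k b<k min-a min-b =
    orbit-injective i a b a<k b<k (toℕ-injective (ℕP.≤-antisym (below a b a<k min-a) (below b a b<k min-b)))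
    where
    below : ∀ a b → a < cycleLen g i → IsMin (iter g a i) → toℕ (iter g a i) ≤ toℕ (iter g b i)
    below a b a<k min-a with reach i a b a<k
    ... | d , e = subst (λ z → toℕ (iter g a i) ≤ toℕ z) e (min-a d)

  M : Fin n → ℕ
  M x = ind (isMin? x)

  orbit-one-min : ∀ i → ΣN.sum {cycleLen g i} (λ j → M (iter g (toℕ j) i)) ≡ 1
  orbit-one-min i with orbit-min i
  ... | j₀ , j₀<k , min₀ = sum-single _ (fromℕ< j₀<k)
    (ind-yes _ (subst (λ z → IsMin (iter g z i)) (sym (toℕ-fromℕ< j₀<k)) min₀))
    (λ j j≢ → ind-no _ λ min-j → j≢ (toℕ-injective
       (trans (orbit-min-unique i (toℕ j) j₀ (toℕ<n j) j₀<k min-j min₀) (sym (toℕ-fromℕ< j₀<k)))))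

  χ : ℕ → Fin n → ℕ
  χ k x = ind (cycleLen g x ℕ.≟ k)

  onCycles : ℕ → ℕ
  onCycles k = length (filter (λ x → cycleLen g x ℕ.≟ k) (allFin n))

  onCycles-sum : ∀ k → onCycles k ≡ ΣN.sum (χ k)
  onCycles-sum k = length-filter (λ x → cycleLen g x ℕ.≟ k) id

  sum-iter : ∀ j (h : Fin n → ℕ) → ΣN.sum (λ x → h (iter g j x)) ≡ ΣN.sum h
  sum-iter zero    h = refl
  sum-iter (suc j) h = begin
    ΣN.sum (λ x → h (g ⟨$⟩ʳ iter g j x))    ≡⟨ ΣN.sum-cong-≗ (λ x → cong h (sym (iter-comm j x))) ⟩
    ΣN.sum (λ x → h (iter g j (g ⟨$⟩ʳ x)))  ≡⟨ sym (ΣN.∑-permute (λ x → h (iter g j x)) g) ⟩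
    ΣN.sum (λ x → h (iter g j x))           ≡⟨ sum-iter j h ⟩
    ΣN.sum h                                ∎
    where open ≡-Reasoning

  -- The points on k-cycles come in groups of k: writing 1 = Σ_{j<k} M(g^j x) for
  -- each such x and exchanging sums gives onCycles k = k · #(k-cycle minima).
  -- This makes numCycles, defined as onCycles k / k, exact.
  onCycles-divisible : ∀ k → suc k ∣ onCycles (suc k)
  onCycles-divisible k = divides C (trans (onCycles-sum K) double-count)
    where
    K : ℕ
    K = suc k
    C : ℕ
    C = ΣN.sum (λ x → χ K x * M x)
    χ-expand : ∀ x → χ K x ≡ χ K x * ΣN.sum {K} (λ j → M (iter g (toℕ j) x))
    χ-expand x with cycleLen g x ℕ.≟ K
    ... | yes e = sym (trans (ℕP.+-identityʳ _) (subst (λ z → ΣN.sum {z} (λ j → M (iter g (toℕ j) x)) ≡ 1) e (orbit-one-min x)))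
    ... | no _  = refl
    shifted : ∀ j → ΣN.sum (λ x → χ K x * M (iter g j x)) ≡ C
    shifted j = trans (ΣN.sum-cong-≗ {n} (λ x → cong (λ z → ind (z ℕ.≟ K) * M (iter g j x)) (sym (cycleLen-iter j x))))
                      (sum-iter j (λ x → χ K x * M x))
    double-count : ΣN.sum (χ K) ≡ C * K
    double-count = begin
      ΣN.sum (χ K)                                                   ≡⟨ ΣN.sum-cong-≗ {n} χ-expand ⟩
      ΣN.sum (λ x → χ K x * ΣN.sum {K} (λ j → M (iter g (toℕ j) x)))  ≡⟨ ΣN.sum-cong-≗ {n} (λ x → SN.*-distribˡ-sum {K} (χ K x) (λ j → M (iter g (toℕ j) x))) ⟩
      ΣN.sum (λ x → ΣN.sum {K} (λ j → χ K x * M (iter g (toℕ j) x)))  ≡⟨ ΣN.∑-comm {n} {K} (λ x j → χ K x * M (iter g (toℕ j) x)) ⟩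
      ΣN.sum {K} (λ j → ΣN.sum (λ x → χ K x * M (iter g (toℕ j) x)))  ≡⟨ ΣN.sum-cong-≗ {K} (λ j → shifted (toℕ j)) ⟩
      ΣN.sum {K} (λ _ → C)                                           ≡⟨ sum-const K C ⟩
      K * C                                                          ≡⟨ ℕP.*-comm K C ⟩
      C * K                                                          ∎
      where open ≡-Reasoning

  one-cycleLen : ∀ x → ΣN.sum {n} (λ j → χ (suc (toℕ j)) x) ≡ 1
  one-cycleLen x with cycleLen g x | cycleLen-pos x | cycleLen-≤ x
  ... | suc k | _ | k<n = sum-single _ (fromℕ< k<n)
    (ind-yes _ (cong suc (sym (toℕ-fromℕ< k<n))))
    (λ j j≢ → ind-no _ λ e → j≢ (toℕ-injective (trans (sym (ℕP.suc-injective e)) (sym (toℕ-fromℕ< k<n)))))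

  onCycles-total : ΣN.sum {n} (λ j → onCycles (suc (toℕ j))) ≡ n
  onCycles-total = begin
    ΣN.sum {n} (λ j → onCycles (suc (toℕ j)))          ≡⟨ ΣN.sum-cong-≗ {n} (λ j → onCycles-sum (suc (toℕ j))) ⟩
    ΣN.sum {n} (λ j → ΣN.sum (χ (suc (toℕ j))))        ≡⟨ ΣN.∑-comm {n} {n} (λ j x → χ (suc (toℕ j)) x) ⟩
    ΣN.sum {n} (λ x → ΣN.sum {n} (λ j → χ (suc (toℕ j)) x)) ≡⟨ ΣN.sum-cong-≗ {n} one-cycleLen ⟩
    ΣN.sum {n} (λ _ → 1)                               ≡⟨ sum-const n 1 ⟩
    n * 1                                              ≡⟨ ℕP.*-identityʳ n ⟩
    n                                                  ∎
    where open ≡-Reasoning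

  cycleType-sum : sumL (cycleType g) ≡ n
  cycleType-sum = begin
    sumL (cycleType g)                                     ≡⟨ sumL-concatMap parts (upTo n) ⟩
    sumL (map (sumL ∘ parts) (upTo n))                     ≡⟨ sumL-applyUpTo n (sumL ∘ parts) id ⟩
    ΣN.sum {n} (λ j → sumL (parts (toℕ j)))                ≡⟨ ΣN.sum-cong-≗ {n} parts-sum ⟩
    ΣN.sum {n} (λ j → onCycles (suc (toℕ j)))              ≡⟨ onCycles-total ⟩
    n                                                      ∎
    where
    open ≡-Reasoning
    parts : ℕ → List ℕ
    parts j = replicate (numCycles g (suc j)) (suc j)
    parts-sum : ∀ (j : Fin n) → sumL (parts (toℕ j)) ≡ onCycles (suc (toℕ j))
    parts-sum j = trans (sumL-replicate (numCycles g (suc (toℕ j))) (suc (toℕ j)))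
                        (m/n*n≡m (onCycles-divisible (toℕ j)))

cycleType-identity : ∀ {n} (e : Permutation′ n) → (∀ i → e ⟨$⟩ʳ i ≡ i) → cycleType e ≡ replicate n 1
cycleType-identity {zero}  e e-id = refl
cycleType-identity {suc n} e e-id = begin
  replicate (numCycles e 1) 1 ++ concatMap parts (applyUpTo suc n)  ≡⟨ cong₂ _++_ ones no-long-parts ⟩
  replicate (suc n) 1 ++ []                                          ≡⟨ ++-identityʳ _ ⟩
  replicate (suc n) 1                                                ∎
  where
  open ≡-Reasoning
  open Orbit e
  parts : ℕ → List ℕ
  parts j = replicate (numCycles e (suc j)) (suc j)
  cycleLen-1 : ∀ i → cycleLen e i ≡ 1
  cycleLen-1 i = cycleLen-unique (s≤s z≤n , e-id i , λ t t≥1 t<1 → ⊥-elim (ℕP.<⇒≱ t<1 t≥1))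
  fixed-points : onCycles 1 ≡ suc n
  fixed-points = begin
    onCycles 1                    ≡⟨ onCycles-sum 1 ⟩
    ΣN.sum (χ 1)                  ≡⟨ ΣN.sum-cong-≗ {suc n} (λ x → ind-yes (cycleLen e x ℕ.≟ 1) (cycleLen-1 x)) ⟩
    ΣN.sum {suc n} (λ _ → 1)      ≡⟨ sum-const (suc n) 1 ⟩
    suc n * 1                     ≡⟨ ℕP.*-identityʳ (suc n) ⟩
    suc n                         ∎
  ones : replicate (numCycles e 1) 1 ≡ replicate (suc n) 1
  ones = cong (λ z → replicate z 1) (trans (n/1≡n (onCycles 1)) fixed-points)
  no-long-cycles : ∀ j → onCycles (suc (suc j)) ≡ 0
  no-long-cycles j = trans (onCycles-sum _)
    (sum-zero {suc n} _ (λ x → ind-no (cycleLen e x ℕ.≟ suc (suc j)) (λ eq → 1≢2+j (trans (sym (cycleLen-1 x)) eq))))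
    where
    1≢2+j : 1 ≢ suc (suc j)
    1≢2+j ()
  no-long-parts : concatMap parts (applyUpTo suc n) ≡ []
  no-long-parts = concatMap-empty parts n suc
    (λ j → cong (λ z → replicate (z / suc (suc j)) (suc (suc j))) (no-long-cycles j))

deg : ∀ {m} → Mon m → ℕ
deg {m} β = ΣN.sum {m} (lookup β)

deg-zipWith : ∀ {m} (a b : Mon m) → deg (zipWith _+_ a b) ≡ deg a + deg b
deg-zipWith {m} a b = trans (ΣN.sum-cong-≗ {m} (λ j → VecP.lookup-zipWith _+_ j a b)) (ΣN.∑-distrib-+ {m} (lookup a) (lookup b))

deg-zero : ∀ m → deg (Vec.replicate m 0) ≡ 0
deg-zero m = sum-zero {m} _ (λ j → VecP.lookup-replicate j 0)

-- The terms of p_k are x_i^k; scaledUnit m k i is their exponent vector k·e_i,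
-- read off from the definition of powerSum.
powerSum-shape : ∀ m k → Σ (Fin m → Fin m → ℕ) λ e → powerSum m k ≡ map (λ i → (tabulate (e i) , 1ℚ)) (allFin m)
powerSum-shape m k = _ , refl

scaledUnit : ∀ m k → Fin m → Fin m → ℕ
scaledUnit m k = proj₁ (powerSum-shape m k)

scaledUnit-diag : ∀ m k i → scaledUnit m k i i ≡ k
scaledUnit-diag m k i with i ≟ᶠ i
... | yes _ = refl
... | no ne = ⊥-elim (ne refl)

scaledUnit-off : ∀ m k i j → j ≢ i → scaledUnit m k i j ≡ 0
scaledUnit-off m k i j j≢i with i ≟ᶠ j
... | yes e = ⊥-elim (j≢i (sym e))
... | no _  = refl

deg-scaledUnit : ∀ m k i → deg (tabulate (scaledUnit m k i)) ≡ k
deg-scaledUnit m k i = trans (ΣN.sum-cong-≗ {m} (VecP.lookup∘tabulate (scaledUnit m k i)))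
                             (sum-single (scaledUnit m k i) i (scaledUnit-diag m k i) (scaledUnit-off m k i))

Homogeneous : ∀ {m} → ℕ → Poly m → Set
Homogeneous d P = All (λ t → deg (proj₁ t) ≡ d) P

homogeneous-powerSum : ∀ m k → Homogeneous k (powerSum m k)
homogeneous-powerSum m k = AllP.map⁺ (All.universal (deg-scaledUnit m k) (allFin m))

homogeneous-* : ∀ {m a b} (P Q : Poly m) → Homogeneous a P → Homogeneous b Q → Homogeneous (a + b) (P *P Q)
homogeneous-* [] Q _ _ = []
homogeneous-* {m} {a} {b} ((x , _) ∷ P) Q (deg-x ∷ hP) hQ =
  AllP.++⁺ (AllP.map⁺ (All.map shift hQ)) (homogeneous-* P Q hP hQ)
  where
  shift : ∀ {y : Mon m} → deg y ≡ b → deg (zipWith _+_ x y) ≡ a + b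
  shift {y} deg-y = trans (deg-zipWith x y) (cong₂ _+_ deg-x deg-y)

homogeneous-pλ : ∀ m λs → Homogeneous (sumL λs) (pλ m λs)
homogeneous-pλ m []       = deg-zero m ∷ []
homogeneous-pλ m (k ∷ λs) = homogeneous-* (powerSum m k) (pλ m λs) (homogeneous-powerSum m k) (homogeneous-pλ m λs)

homogeneous-scale : ∀ {m d} t (P : Poly m) → Homogeneous d P → Homogeneous d (scaleP t P)
homogeneous-scale t P hP = AllP.map⁺ hP

homogeneous-support : ∀ {m d} {α : Mon m} (P : Poly m) → Homogeneous d P → ¬ (coeff α P ≡ 0ℚ) → deg α ≡ d
homogeneous-support [] _ coeff≢0 = ⊥-elim (coeff≢0 refl)
homogeneous-support {α = α} ((β , c) ∷ P) (deg-β ∷ hP) coeff≢0 with VecP.≡-dec ℕ._≟_ β α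
... | yes refl = deg-β
... | no _     = homogeneous-support P hP coeff≢0

UnitCoeffs : ∀ {m} → Poly m → Set
UnitCoeffs P = All (λ t → proj₂ t ≡ 1ℚ) P

unitCoeffs-powerSum : ∀ m k → UnitCoeffs (powerSum m k)
unitCoeffs-powerSum m k = AllP.map⁺ (All.universal (λ _ → refl) (allFin m))

unitCoeffs-* : ∀ {m} (P Q : Poly m) → UnitCoeffs P → UnitCoeffs Q → UnitCoeffs (P *P Q)
unitCoeffs-* [] Q _ _ = []
unitCoeffs-* ((_ , c) ∷ P) Q (c≡1 ∷ uP) uQ =
  AllP.++⁺ (AllP.map⁺ (All.map (λ d≡1 → cong₂ ℚ._*_ c≡1 d≡1) uQ)) (unitCoeffs-* P Q uP uQ)

unitCoeffs-pλ : ∀ m λs → UnitCoeffs (pλ m λs)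
unitCoeffs-pλ m []       = refl ∷ []
unitCoeffs-pλ m (k ∷ λs) = unitCoeffs-* (powerSum m k) (pλ m λs) (unitCoeffs-powerSum m k) (unitCoeffs-pλ m λs)

Occurs : ∀ {m} → Poly m → Mon m → Set
Occurs P α = Any (λ t → proj₁ t ≡ α) P

occurs-* : ∀ {m} (P Q : Poly m) {β c γ} → (β , c) ∈ P → Occurs Q γ → Occurs (P *P Q) (zipWith _+_ β γ)
occurs-* ((β , c) ∷ P) Q (here refl) occ = AnyP.++⁺ˡ (AnyP.map⁺ (Any.map (cong (zipWith _+_ β)) occ))
occurs-* (_ ∷ P) Q (there mem) occ = AnyP.++⁺ʳ _ (occurs-* P Q mem occ)

occurs-scale : ∀ {m} t (P : Poly m) {α} → Occurs P α → Occurs (scaleP t P) α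
occurs-scale t P occ = AnyP.map⁺ occ

vec-ext : ∀ {m} {a b : Vec ℕ m} → (∀ j → lookup a j ≡ lookup b j) → a ≡ b
vec-ext h = Pointwise-≡⇒≡ (ext h)

-- p_1^k contains every monomial of degree k: peel off a variable x_i with α_i ≥ 1.
occurs-p₁-power : ∀ m k (α : Mon m) → deg α ≡ k → Occurs (pλ m (replicate k 1)) α
occurs-p₁-power m zero α deg≡0 =
  here (vec-ext λ j → trans (VecP.lookup-replicate j 0) (sym (sum-zero⁻¹ (lookup α) deg≡0 j)))
occurs-p₁-power m (suc k) α deg≡1+k =
  subst (Occurs (pλ m (replicate (suc k) 1))) split
    (occurs-* (powerSum m 1) (pλ m (replicate k 1)) eᵢ-term (occurs-p₁-power m k α′ deg-α′))
  where
  i : Fin m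
  i = proj₁ (sum-positive (lookup α) deg≡1+k)
  eᵢ : Fin m → ℕ
  eᵢ = scaledUnit m 1 i
  α′ : Mon m
  α′ = tabulate (λ j → lookup α j ∸ eᵢ j)
  eᵢ≤α : ∀ j → eᵢ j ≤ lookup α j
  eᵢ≤α j with j ≟ᶠ i
  ... | yes refl = subst (_≤ lookup α i) (sym (scaledUnit-diag m 1 i)) (proj₂ (sum-positive (lookup α) deg≡1+k))
  ... | no j≢i   = subst (_≤ lookup α j) (sym (scaledUnit-off m 1 i j j≢i)) z≤n
  split : zipWith _+_ (tabulate eᵢ) α′ ≡ α
  split = vec-ext λ j → begin
    lookup (zipWith _+_ (tabulate eᵢ) α′) j  ≡⟨ VecP.lookup-zipWith _+_ j (tabulate eᵢ) α′ ⟩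
    lookup (tabulate eᵢ) j + lookup α′ j     ≡⟨ cong₂ _+_ (VecP.lookup∘tabulate eᵢ j) (VecP.lookup∘tabulate (λ j → lookup α j ∸ eᵢ j) j) ⟩
    eᵢ j + (lookup α j ∸ eᵢ j)               ≡⟨ ℕP.m+[n∸m]≡n (eᵢ≤α j) ⟩
    lookup α j                               ∎
    where open ≡-Reasoning
  deg-α′ : deg α′ ≡ k
  deg-α′ = ℕP.suc-injective (begin
    suc (deg α′)                             ≡⟨ cong (_+ deg α′) (sym (deg-scaledUnit m 1 i)) ⟩
    deg (tabulate eᵢ) + deg α′               ≡⟨ sym (deg-zipWith (tabulate eᵢ) α′) ⟩
    deg (zipWith _+_ (tabulate eᵢ) α′)       ≡⟨ cong deg split ⟩
    deg α                                    ≡⟨ deg≡1+k ⟩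
    suc k                                    ∎)
    where open ≡-Reasoning
  eᵢ-term : (tabulate eᵢ , 1ℚ) ∈ powerSum m 1
  eᵢ-term = AnyP.map⁺ (Any.map (cong (λ k → (tabulate (scaledUnit m 1 k) , 1ℚ))) (∈-allFin i))

coeff-nonneg : ∀ {m} α (P : Poly m) → All (λ t → 0ℚ ℚ.≤ proj₂ t) P → 0ℚ ℚ.≤ coeff α P
coeff-nonneg α [] _ = ℚP.≤-refl
coeff-nonneg α ((β , c) ∷ P) (c≥0 ∷ P≥0) with VecP.≡-dec ℕ._≟_ β α
... | yes _ = ℚP.+-mono-≤ c≥0 (coeff-nonneg α P P≥0)
... | no _  = coeff-nonneg α P P≥0

-- With positive coefficients there is no cancellation: occurring monomials have coefficient > 0.
coeff-pos : ∀ {m} α (P : Poly m) → All (λ t → 0ℚ ℚ.< proj₂ t) P → Occurs P α → 0ℚ ℚ.< coeff α P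
coeff-pos α ((β , c) ∷ P) (c>0 ∷ P>0) occ with VecP.≡-dec ℕ._≟_ β α | occ
... | yes _   | _        = ℚP.+-mono-<-≤ c>0 (coeff-nonneg α P (All.map ℚP.<⇒≤ P>0))
... | no β≢α  | here e   = ⊥-elim (β≢α e)
... | no _    | there o  = coeff-pos α P P>0 o

positive-scale : ∀ {m} t (P : Poly m) → 0ℚ ℚ.< t → UnitCoeffs P → All (λ u → 0ℚ ℚ.< proj₂ u) (scaleP t P)
positive-scale t P t>0 uP =
  AllP.map⁺ (All.map (λ c≡1 → subst (0ℚ ℚ.<_) (sym (trans (cong (t ℚ.*_) c≡1) (ℚP.*-identityʳ t))) t>0) uP)

cycleSum : ∀ {n} m → List (Permutation′ n) → Poly m
cycleSum m E = foldr (λ g P → pλ m (cycleType g) +P P) [] E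

homogeneous-cycleSum : ∀ {n} m (E : List (Permutation′ n)) → Homogeneous n (cycleSum m E)
homogeneous-cycleSum m []      = []
homogeneous-cycleSum m (g ∷ E) =
  AllP.++⁺ (subst (λ d → Homogeneous d (pλ m (cycleType g))) (Orbit.cycleType-sum g) (homogeneous-pλ m (cycleType g)))
           (homogeneous-cycleSum m E)

unitCoeffs-cycleSum : ∀ {n} m (E : List (Permutation′ n)) → UnitCoeffs (cycleSum m E)
unitCoeffs-cycleSum m []      = []
unitCoeffs-cycleSum m (g ∷ E) = AllP.++⁺ (unitCoeffs-pλ m (cycleType g)) (unitCoeffs-cycleSum m E)

occurs-cycleSum : ∀ {n} m (E : List (Permutation′ n)) {α : Mon m} →
                  Any (λ e → ∀ i → e ⟨$⟩ʳ i ≡ i) E → deg α ≡ n → Occurs (cycleSum m E) α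
occurs-cycleSum {n} m (e ∷ E) {α} (here e-id) deg-α =
  AnyP.++⁺ˡ (subst (λ λs → Occurs (pλ m λs) α) (sym (cycleType-identity e e-id)) (occurs-p₁-power m n α deg-α))
occurs-cycleSum m (_ ∷ E) (there has-id) deg-α = AnyP.++⁺ʳ _ (occurs-cycleSum m E has-id deg-α)

inv-length-pos : ∀ {A : Set} (E : List A) {P : A → Set} → Any P E → 0ℚ ℚ.< inv (length E)
inv-length-pos (_ ∷ E) _ = ℚP.positive⁻¹ _ {{ℚP.normalize-pos 1 (suc (length E))}}

toℚ-mkℚ : ∀ k → toℚ k ≡ mkℚ (ℤ.+ k) 0 (Coprime.sym (Coprime.1-coprimeTo k))
toℚ-mkℚ k = ℚP.normalize-coprime (Coprime.sym (Coprime.1-coprimeTo k))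

toℚ-+ : ∀ a b → toℚ (a + b) ≡ toℚ a ℚ.+ toℚ b
toℚ-+ a b = trans (cong (ℚ._/ 1) numerators) (sym (cong₂ ℚ._+_ (toℚ-mkℚ a) (toℚ-mkℚ b)))
  where
  numerators : ℤ.+ (a + b) ≡ ℤ.+ a ℤ.* ℤ.+ 1 ℤ.+ ℤ.+ b ℤ.* ℤ.+ 1
  numerators = trans (ℤP.pos-+ a b) (sym (cong₂ ℤ._+_ (ℤP.*-identityʳ (ℤ.+ a)) (ℤP.*-identityʳ (ℤ.+ b))))

toℚ-injective : ∀ {a b} → toℚ a ≡ toℚ b → a ≡ b
toℚ-injective {a} {b} e = ℤP.+-injective (proj₁ (ℚP.mkℚ-injective (trans (sym (toℚ-mkℚ a)) (trans e (toℚ-mkℚ b)))))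

toℚ-sum : ∀ {k} (h : Fin k → ℕ) → ΣQ.sum (toℚ ∘ h) ≡ toℚ (ΣN.sum h)
toℚ-sum {zero}  h = refl
toℚ-sum {suc k} h = trans (cong (toℚ (h F.zero) ℚ.+_) (toℚ-sum (h ∘ F.suc))) (sym (toℚ-+ (h F.zero) (ΣN.sum (h ∘ F.suc))))

termSum : ∀ {m} → (Mon m → ℚ → ℚ) → List (Mon m × ℚ) → ℚ
termSum ψ = foldr (λ t s → ψ (proj₁ t) (proj₂ t) ℚ.+ s) 0ℚ

termSum-cong : ∀ {m} {ψ₁ ψ₂ : Mon m → ℚ → ℚ} L →
               All (λ t → ψ₁ (proj₁ t) (proj₂ t) ≡ ψ₂ (proj₁ t) (proj₂ t)) L → termSum ψ₁ L ≡ termSum ψ₂ L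
termSum-cong []      []       = refl
termSum-cong (_ ∷ L) (e ∷ es) = cong₂ ℚ._+_ e (termSum-cong L es)

termSum-*ʳ : ∀ {m} (ψ : Mon m → ℚ → ℚ) c L → termSum (λ β w → ψ β w ℚ.* c) L ≡ termSum ψ L ℚ.* c
termSum-*ʳ ψ c []            = sym (ℚP.*-zeroˡ c)
termSum-*ʳ ψ c ((β , w) ∷ L) = trans (cong (ψ β w ℚ.* c ℚ.+_) (termSum-*ʳ ψ c L)) (sym (ℚP.*-distribʳ-+ c (ψ β w) (termSum ψ L)))

termSum-Σ : ∀ {m k} (ψ : Fin k → Mon m → ℚ → ℚ) L →
            ΣQ.sum (λ j → termSum (ψ j) L) ≡ termSum (λ β w → ΣQ.sum (λ j → ψ j β w)) L
termSum-Σ {k = k} ψ []        = ΣQ.sum-replicate-zero k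
termSum-Σ {k = k} ψ ((β , w) ∷ L) =
  trans (ΣQ.∑-distrib-+ {k} (λ j → ψ j β w) (λ j → termSum (ψ j) L)) (cong (ΣQ.sum (λ j → ψ j β w) ℚ.+_) (termSum-Σ ψ L))

weighted-deg : ∀ {m} (β : Mon m) w → ΣQ.sum {m} (λ j → w ℚ.* toℚ (lookup β j)) ≡ w ℚ.* toℚ (deg β)
weighted-deg {m} β w = trans (sym (SQ.*-distribˡ-sum {m} w (toℚ ∘ lookup β))) (cong (w ℚ.*_) (toℚ-sum (lookup β)))

-- A lattice point of the Newton polytope of a homogeneous polynomial of degree d
-- has degree d: |α| = Σ_j Σ_L w·β_j = Σ_L w·|β| = d · Σ_L w = d.
newton-degree : ∀ {m d} (h : Poly m) (α : Mon m) → Homogeneous d h → InNewtonPolytope h α → deg α ≡ d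
newton-degree {m} {d} h α hom (L , support , total , barycentre) = toℚ-injective (begin
  toℚ (deg α)                                               ≡⟨ sym (toℚ-sum (lookup α)) ⟩
  ΣQ.sum (λ j → toℚ (lookup α j))                           ≡⟨ ΣQ.sum-cong-≗ {m} (sym ∘ barycentre) ⟩
  ΣQ.sum (λ j → termSum (λ β w → w ℚ.* toℚ (lookup β j)) L)  ≡⟨ termSum-Σ (λ j β w → w ℚ.* toℚ (lookup β j)) L ⟩
  termSum (λ β w → ΣQ.sum (λ j → w ℚ.* toℚ (lookup β j))) L  ≡⟨ termSum-cong L (All.universal (λ t → weighted-deg (proj₁ t) (proj₂ t)) L) ⟩
  termSum (λ β w → w ℚ.* toℚ (deg β)) L                      ≡⟨ termSum-cong L (All.map (λ {t} → cong (λ k → proj₂ t ℚ.* toℚ k)) degrees) ⟩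
  termSum (λ _ w → w ℚ.* toℚ d) L                            ≡⟨ termSum-*ʳ (λ _ w → w) (toℚ d) L ⟩
  termSum (λ _ w → w) L ℚ.* toℚ d                            ≡⟨ cong (ℚ._* toℚ d) total ⟩
  1ℚ ℚ.* toℚ d                                               ≡⟨ ℚP.*-identityˡ (toℚ d) ⟩
  toℚ d                                                      ∎)
  where
  open ≡-Reasoning
  degrees : All (λ t → deg (proj₁ t) ≡ d) L
  degrees = All.map (λ p → homogeneous-support h hom (proj₁ p)) support

theorem2p30 : ∀ (n : ℕ) (G : Subgroup n) → SymSNP (cycleIndex G)
theorem2p30 n G m α in-polytope coeff≡0 = ℚP.<-irrefl (sym coeff≡0) coeff>0
  where
  E : List (Permutation′ n)
  E = Subgroup.elems G
  t : ℚ
  t = inv (length E)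
  homogeneous : Homogeneous n (cycleIndex G m)
  homogeneous = homogeneous-scale t (cycleSum m E) (homogeneous-cycleSum m E)
  deg-α : deg α ≡ n
  deg-α = newton-degree (cycleIndex G m) α homogeneous in-polytope
  coeff>0 : 0ℚ ℚ.< coeff α (cycleIndex G m)
  coeff>0 = coeff-pos α (cycleIndex G m)
    (positive-scale t (cycleSum m E) (inv-length-pos E (Subgroup.hasId G)) (unitCoeffs-cycleSum m E))
    (occurs-scale t (cycleSum m E) (occurs-cycleSum m E (Subgroup.hasId G) deg-α))
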